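{- For any positive integer $d$, the ordinary generating function $G_{d,1}(x)=\sum_{s=1}^{\infty}N_{d,1}(s)x^s$ equals $$G_{d,1}(x)=\frac{x(1-x^{d+1})}{(1-x-x^{d+1})(1-x)}$$ (as formal power series).
   Context: A partition $\lambda=(\lambda_1,\dots,\lambda_k)$ is a finite nonincreasing sequence of positive integers (the empty partition is allowed). In its Young diagram, the hook length of a cell is $1$ plus the number of cells to its right in its row plus the number of cells below it in its column. For a positive integer $t$, $\lambda$ is $t$-core if no cell has hook length $t$; $(s,s+1)$-core means both $s$-core and $(s+1)$-core. $\lambda$ has $d$-distinct parts if $\lambda_i-\lambda_{i+1}\ge d$ for all $1\le i\le k-1$. $N_{d,1}(s)$ is the number of $(s,s+1)$-core partitions with $d$-distinct parts. -}

module Defs where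

open import Data.Nat as ℕ using (ℕ; zero; suc; _+_; _∸_; _<_; _≤_; _≥_; _<ᵇ_)
open import Data.Integer as ℤ using (ℤ; +_)
open import Data.List using (List; []; _∷_; length; lookup; drop; filterᵇ; map; sum; upTo)
open import Data.List.Relation.Unary.All using (All)
open import Data.List.Relation.Unary.Linked using (Linked)
open import Data.List.Relation.Unary.Unique.Propositional using (Unique)
open import Data.List.Membership.Propositional using (_∈_)
open import Data.Fin using (Fin; toℕ)
open import Data.Product using (Σ; _×_; ∃)
open import Relation.Nullary using (¬_)
open import Relation.Binary.PropositionalEquality using (_≡_)

IsPartition : List ℕ → Set
IsPartition λs = All (0 <_) λs × Linked _≥_ λs

DDistinct : ℕ → List ℕ → Set
DDistinct d λs = Linked (λ a b → d + b ≤ a) λs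

-- cell (i , j) (0-indexed row i, column j) with j < λᵢ.
-- arm  = number of cells to the right in row i   = λᵢ - (j+1)
-- leg  = number of cells below in column j       = #{k > i : λₖ > j}
arm : (λs : List ℕ) → Fin (length λs) → ℕ → ℕ
arm λs i j = lookup λs i ∸ suc j

leg : (λs : List ℕ) → Fin (length λs) → ℕ → ℕ
leg λs i j = length (filterᵇ (λ p → j <ᵇ p) (drop (suc (toℕ i)) λs))

hook : (λs : List ℕ) → Fin (length λs) → ℕ → ℕ
hook λs i j = suc (arm λs i j + leg λs i j)

HasHook : ℕ → List ℕ → Set
HasHook t λs = Σ (Fin (length λs)) λ i → Σ ℕ λ j → (j < lookup λs i) × (hook λs i j ≡ t)

IsCore : ℕ → List ℕ → Set
IsCore t λs = ¬ HasHook t λs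

Good : ℕ → ℕ → List ℕ → Set
Good d s λs = IsPartition λs × IsCore s λs × IsCore (suc s) λs × DDistinct d λs

-- "the number of objects satisfying P is exactly n":
-- there is a duplicate-free list enumerating precisely the objects satisfying P, of length n
HasCount : {A : Set} → (A → Set) → ℕ → Set
HasCount {A} P n = Σ (List A) λ L →
  Unique L × All P L × (∀ a → P a → a ∈ L) × (length L ≡ n)

Series : Set
Series = ℕ → ℤ

infixl 6 _⊕_ _⊖_
infixl 7 _⊛_

_⊕_ : Series → Series → Series
(f ⊕ g) n = f n ℤ.+ g n

_⊖_ : Series → Series → Series
(f ⊖ g) n = f n ℤ.- g n

_⊛_ : Series → Series → Series
(f ⊛ g) n = Data.List.foldr ℤ._+_ (+ 0) (map (λ k → f k ℤ.* g (n ∸ k)) (upTo (suc n)))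

one : Series
one zero = + 1
one (suc _) = + 0

X : Series
X (suc zero) = + 1
X _ = + 0

Xpow : ℕ → Series
Xpow zero = one
Xpow (suc k) = X ⊛ Xpow k

genFun : (ℕ → ℕ) → Series
genFun N zero = + 0
genFun N (suc s) = + N (suc s)

-- A partition with d-distinct parts, d ≥ 1, has distinct parts, so along its first row the hook
-- lengths fall from the corner hook h + ℓ (the largest hook) down to 1 in steps of at most 2.
-- Hence it is an (s, s+1)-core exactly when all its hooks are < s. The partitions whose corner
-- hook is exactly M are obtained by putting a first row on top of any partition whose hooks are
-- < M - d, so the counts N(m) satisfy N(m+2) = N(m+1) + N(m+1-d) with N(0) = N(1) = 1. On
-- coefficients this says (1-x)G - x^{d+1}G = x(1 + x + ⋯ + x^d), and multiplying by 1 - x gives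
-- the identity.
module Submission where

open import Defs
open import Data.Nat
open import Data.Nat.Properties
open import Data.Nat.Tactic.RingSolver using (solve-∀)
open import Data.Integer as ℤ using (ℤ; +_)
import Data.Integer.Properties as ℤ
open import Data.Bool using (T?)
open import Data.Fin using (Fin; toℕ; zero; suc; opposite)
open import Data.Fin.Properties using (opposite-prop; toℕ≤pred[n])
import Data.Fin.Permutation as Perm
open import Data.List using (List; []; _∷_; length; lookup; drop; filterᵇ; foldr; map; _++_; applyUpTo; upTo)
open import Data.List.Properties
  using (map-cong; length-++; length-map; ∷-injectiveʳ; length-filter; length-drop;
         filter-all; filter-none; filter-accept)
open import Data.List.Membership.Propositional using (_∈_)
open import Data.List.Membership.Propositional.Properties
  using (∈-lookup; ∈-++⁻; ∈-++⁺ˡ; ∈-++⁺ʳ; ∈-map⁻; ∈-map⁺)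
open import Data.List.Relation.Unary.Any using (here)
open import Data.List.Relation.Unary.All as All using (All; []; _∷_)
open import Data.List.Relation.Unary.AllPairs using ([]; _∷_)
open import Data.List.Relation.Unary.Linked as Linked using (Linked; []; [-]; _∷_)
open import Data.List.Relation.Unary.Linked.Properties using (Linked⇒All)
open import Data.List.Relation.Unary.Unique.Propositional using (Unique)
import Data.List.Relation.Unary.Unique.Propositional.Properties as Unique
open import Data.List.Relation.Binary.Disjoint.Propositional using (Disjoint)
open import Data.Product using (Σ; _×_; _,_; ∃-syntax)
open import Data.Sum as Sum using (_⊎_; inj₁; inj₂; [_,_]′)
open import Data.Unit using (⊤; tt)
open import Data.Empty using (⊥-elim)
open import Function using (_∘_; flip)
open import Relation.Nullary using (¬_; yes; no; contradiction)
open import Relation.Binary.Definitions using (tri<; tri≈; tri>)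
open import Relation.Binary.PropositionalEquality
open import Algebra.Properties.CommutativeMonoid.Sum ℤ.+-0-commutativeMonoid
  using (sum-syntax; sum⁺-syntax; sum-cong-≗; ∑-distrib-+; ∑-permute; sum-replicate-zero)

foldr-map-applyUpTo : ∀ (h : ℕ → ℤ) g n →
  foldr ℤ._+_ (+ 0) (map h (applyUpTo g n)) ≡ ∑[ i < n ] h (g (toℕ i))
foldr-map-applyUpTo h g zero    = refl
foldr-map-applyUpTo h g (suc n) = cong (ℤ._+_ (h (g 0))) (foldr-map-applyUpTo h (g ∘ suc) n)

⊛-∑ : ∀ f g n → (f ⊛ g) n ≡ ∑[ k ≤ n ] (f (toℕ k) ℤ.* g (n ∸ toℕ k))
⊛-∑ f g n = foldr-map-applyUpTo (λ k → f k ℤ.* g (n ∸ k)) (λ k → k) (suc n)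

⊛-cong : ∀ {f f′ g g′} → f ≗ f′ → g ≗ g′ → f ⊛ g ≗ f′ ⊛ g′
⊛-cong f≗f′ g≗g′ n =
  cong (foldr ℤ._+_ (+ 0)) (map-cong (λ k → cong₂ ℤ._*_ (f≗f′ k) (g≗g′ (n ∸ k))) (upTo (suc n)))

⊛-congˡ : ∀ {f f′} g → f ≗ f′ → f ⊛ g ≗ f′ ⊛ g
⊛-congˡ g f≗f′ = ⊛-cong f≗f′ (λ _ → refl)

⊛-comm : ∀ f g → f ⊛ g ≗ g ⊛ f
⊛-comm f g n = begin
  (f ⊛ g) n                                                  ≡⟨ ⊛-∑ f g n ⟩
  ∑[ k ≤ n ] (f (toℕ k) ℤ.* g (n ∸ toℕ k))                   ≡⟨ ∑-permute (λ k → f (toℕ k) ℤ.* g (n ∸ toℕ k)) Perm.reverse ⟩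
  ∑[ k ≤ n ] (f (toℕ (opposite k)) ℤ.* g (n ∸ toℕ (opposite k))) ≡⟨ sum-cong-≗ reflect ⟩
  ∑[ k ≤ n ] (g (toℕ k) ℤ.* f (n ∸ toℕ k))                   ≡⟨ ⊛-∑ g f n ⟨
  (g ⊛ f) n                                                  ∎
  where
  open ≡-Reasoning
  reflect : ∀ k → f (toℕ (opposite k)) ℤ.* g (n ∸ toℕ (opposite k)) ≡ g (toℕ k) ℤ.* f (n ∸ toℕ k)
  reflect k = begin
    f (toℕ (opposite k)) ℤ.* g (n ∸ toℕ (opposite k)) ≡⟨ cong (λ j → f j ℤ.* g (n ∸ j)) (opposite-prop k) ⟩
    f (n ∸ toℕ k) ℤ.* g (n ∸ (n ∸ toℕ k))           ≡⟨ cong (λ j → f (n ∸ toℕ k) ℤ.* g j) (m∸[m∸n]≡n (toℕ≤pred[n] k)) ⟩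
    f (n ∸ toℕ k) ℤ.* g (toℕ k)                     ≡⟨ ℤ.*-comm (f (n ∸ toℕ k)) (g (toℕ k)) ⟩
    g (toℕ k) ℤ.* f (n ∸ toℕ k)                     ∎

∑-neg : ∀ n (t : Fin n → ℤ) → ∑[ i < n ] (ℤ.- t i) ≡ ℤ.- ∑[ i < n ] t i
∑-neg zero    t = refl
∑-neg (suc n) t = trans (cong (ℤ._+_ (ℤ.- t zero)) (∑-neg n (t ∘ suc)))
                        (sym (ℤ.neg-distrib-+ (t zero) _))

⊛-distribʳ-⊖ : ∀ f g h → (f ⊖ g) ⊛ h ≗ f ⊛ h ⊖ g ⊛ h
⊛-distribʳ-⊖ f g h n = begin
  ((f ⊖ g) ⊛ h) n                                             ≡⟨ ⊛-∑ (f ⊖ g) h n ⟩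
  ∑[ k ≤ n ] ((f (toℕ k) ℤ.- g (toℕ k)) ℤ.* h (n ∸ toℕ k))   ≡⟨ sum-cong-≗ {suc n} (λ k → distrib (f (toℕ k)) (g (toℕ k)) (h (n ∸ toℕ k))) ⟩
  ∑[ k ≤ n ] (fh k ℤ.+ ℤ.- gh k)                              ≡⟨ ∑-distrib-+ fh (λ k → ℤ.- gh k) ⟩
  ∑[ k ≤ n ] fh k ℤ.+ ∑[ k ≤ n ] (ℤ.- gh k)                   ≡⟨ cong (ℤ._+_ (∑[ k ≤ n ] fh k)) (∑-neg (suc n) gh) ⟩
  ∑[ k ≤ n ] fh k ℤ.- ∑[ k ≤ n ] gh k                         ≡⟨ cong₂ ℤ._-_ (⊛-∑ f h n) (⊛-∑ g h n) ⟨
  (f ⊛ h ⊖ g ⊛ h) n                                           ∎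
  where
  open ≡-Reasoning
  fh gh : Fin (suc n) → ℤ
  fh k = f (toℕ k) ℤ.* h (n ∸ toℕ k)
  gh k = g (toℕ k) ℤ.* h (n ∸ toℕ k)
  distrib : ∀ a b c → (a ℤ.- b) ℤ.* c ≡ a ℤ.* c ℤ.+ ℤ.- (b ℤ.* c)
  distrib a b c = trans (ℤ.*-distribʳ-+ c a (ℤ.- b)) (cong (ℤ._+_ (a ℤ.* c)) (sym (ℤ.neg-distribˡ-* b c)))

shift : ℕ → Series → Series
shift zero    f n       = f n
shift (suc k) f zero    = + 0
shift (suc k) f (suc n) = shift k f n

shift-cong : ∀ k {f g} → f ≗ g → shift k f ≗ shift k g
shift-cong zero    f≗g n       = f≗g n
shift-cong (suc k) f≗g zero    = refl
shift-cong (suc k) f≗g (suc n) = shift-cong k f≗g n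

shift-suc : ∀ k f → shift (suc k) f ≗ shift 1 (shift k f)
shift-suc k f zero    = refl
shift-suc k f (suc n) = refl

shift-⊛ : ∀ k f g → shift k f ⊛ g ≗ shift k (f ⊛ g)
shift-⊛ zero    f g n       = refl
shift-⊛ (suc k) f g zero    = refl
shift-⊛ (suc k) f g (suc n) = begin
  (shift (suc k) f ⊛ g) (suc n)                            ≡⟨ ⊛-∑ (shift (suc k) f) g (suc n) ⟩
  + 0 ℤ.+ ∑[ i ≤ n ] (shift k f (toℕ i) ℤ.* g (n ∸ toℕ i))  ≡⟨ ℤ.+-identityˡ _ ⟩
  ∑[ i ≤ n ] (shift k f (toℕ i) ℤ.* g (n ∸ toℕ i))          ≡⟨ ⊛-∑ (shift k f) g n ⟨
  (shift k f ⊛ g) n                                        ≡⟨ shift-⊛ k f g n ⟩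
  shift k (f ⊛ g) n                                        ∎
  where open ≡-Reasoning

⊛-identityˡ : ∀ f → one ⊛ f ≗ f
⊛-identityˡ f n = begin
  (one ⊛ f) n                                            ≡⟨ ⊛-∑ one f n ⟩
  + 1 ℤ.* f n ℤ.+ ∑[ i < n ] (+ 0 ℤ.* f (n ∸ suc (toℕ i))) ≡⟨ cong₂ ℤ._+_ (ℤ.*-identityˡ (f n)) (sum-replicate-zero n) ⟩
  f n ℤ.+ + 0                                            ≡⟨ ℤ.+-identityʳ (f n) ⟩
  f n                                                    ∎
  where open ≡-Reasoning

X-⊛ : ∀ f → X ⊛ f ≗ shift 1 f
X-⊛ f n = begin
  (X ⊛ f) n           ≡⟨ ⊛-congˡ f X≗shift-one n ⟩
  (shift 1 one ⊛ f) n ≡⟨ shift-⊛ 1 one f n ⟩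
  shift 1 (one ⊛ f) n ≡⟨ shift-cong 1 (⊛-identityˡ f) n ⟩
  shift 1 f n         ∎
  where
  open ≡-Reasoning
  X≗shift-one : X ≗ shift 1 one
  X≗shift-one zero          = refl
  X≗shift-one (suc zero)    = refl
  X≗shift-one (suc (suc n)) = refl

Xpow≗shift-one : ∀ k → Xpow k ≗ shift k one
Xpow≗shift-one zero    n = refl
Xpow≗shift-one (suc k) n = begin
  (X ⊛ Xpow k) n         ≡⟨ X-⊛ (Xpow k) n ⟩
  shift 1 (Xpow k) n     ≡⟨ shift-cong 1 (Xpow≗shift-one k) n ⟩
  shift 1 (shift k one) n ≡⟨ shift-suc k one n ⟨
  shift (suc k) one n    ∎
  where open ≡-Reasoning

Xpow-⊛ : ∀ k f → Xpow k ⊛ f ≗ shift k f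
Xpow-⊛ k f n = begin
  (Xpow k ⊛ f) n      ≡⟨ ⊛-congˡ f (Xpow≗shift-one k) n ⟩
  (shift k one ⊛ f) n ≡⟨ shift-⊛ k one f n ⟩
  shift k (one ⊛ f) n ≡⟨ shift-cong k (⊛-identityˡ f) n ⟩
  shift k f n         ∎
  where open ≡-Reasoning

Δ : Series → Series
Δ f = f ⊖ shift 1 f

Δ-cong : ∀ {f g} → f ≗ g → Δ f ≗ Δ g
Δ-cong f≗g n = cong₂ ℤ._-_ (f≗g n) (shift-cong 1 f≗g n)

[one⊖X]-⊛ : ∀ f → (one ⊖ X) ⊛ f ≗ Δ f
[one⊖X]-⊛ f n = trans (⊛-distribʳ-⊖ one X f n) (cong₂ ℤ._-_ (⊛-identityˡ f n) (X-⊛ f n))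

Δ-⊛ : ∀ f g → Δ f ⊛ g ≗ Δ (f ⊛ g)
Δ-⊛ f g n = trans (⊛-distribʳ-⊖ f (shift 1 f) g n) (cong (ℤ._-_ ((f ⊛ g) n)) (shift-⊛ 1 f g n))

Δ-shift : ∀ f → Δ (shift 1 f) ≗ shift 1 (Δ f)
Δ-shift f zero    = refl
Δ-shift f (suc n) = refl

geom : ℕ → Series
geom zero    n       = one n
geom (suc d) zero    = + 1
geom (suc d) (suc n) = geom d n

Δ-geom : ∀ d → Δ (geom d) ≗ one ⊖ shift (suc d) one
Δ-geom zero          zero          = refl
Δ-geom zero          (suc zero)    = refl
Δ-geom zero          (suc (suc n)) = refl
Δ-geom (suc d)       zero          = refl
Δ-geom (suc zero)    (suc zero)    = refl
Δ-geom (suc (suc d)) (suc zero)    = refl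
Δ-geom (suc d)       (suc (suc n)) = Δ-geom d (suc n)

module _ {d : ℕ} {N : ℕ → ℕ} (N₀ : N 0 ≡ 1) (N₁ : N 1 ≡ 1)
         (N-rec : ∀ m → N (2 + m) ≡ N (1 + m) + N (1 + m ∸ d)) where

  private
    G : Series
    G = genFun N

  N[∸]-shift-genFun : ∀ k m → + N (m ∸ k) ℤ.- shift k G m ≡ geom k m
  N[∸]-shift-genFun zero    zero    rewrite N₀ = refl
  N[∸]-shift-genFun zero    (suc m) = ℤ.+-inverseʳ (+ N (suc m))
  N[∸]-shift-genFun (suc k) zero    rewrite N₀ = refl
  N[∸]-shift-genFun (suc k) (suc m) = N[∸]-shift-genFun k m

  Δ-genFun-suc : ∀ m → Δ G (suc m) ≡ + N (m ∸ d)
  Δ-genFun-suc zero    rewrite N₁ | 0∸n≡0 d | N₀ = refl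
  Δ-genFun-suc (suc m) rewrite N-rec m = begin
    + (N (suc m) + N (suc m ∸ d)) ℤ.- + N (suc m) ≡⟨ ℤ.m-n≡m⊖n (N (suc m) + N (suc m ∸ d)) (N (suc m)) ⟩
    N (suc m) + N (suc m ∸ d) ℤ.⊖ N (suc m)       ≡⟨ ℤ.⊖-≥ (m≤m+n (N (suc m)) _) ⟩
    + (N (suc m) + N (suc m ∸ d) ∸ N (suc m))     ≡⟨ cong +_ (m+n∸m≡n (N (suc m)) _) ⟩
    + N (suc m ∸ d)                                 ∎
    where open ≡-Reasoning

  Δ-genFun-⊖-shift : Δ G ⊖ shift (suc d) G ≗ shift 1 (geom d)
  Δ-genFun-⊖-shift zero    = refl
  Δ-genFun-⊖-shift (suc m) = trans (cong (ℤ._- shift d G m) (Δ-genFun-suc m)) (N[∸]-shift-genFun d m)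

  genFun-identity : G ⊛ ((one ⊖ X ⊖ Xpow (suc d)) ⊛ (one ⊖ X)) ≗ X ⊛ (one ⊖ Xpow (suc d))
  genFun-identity = begin
    G ⊛ (P ⊛ (one ⊖ X))                ≈⟨ ⊛-comm G (P ⊛ (one ⊖ X)) ⟩
    (P ⊛ (one ⊖ X)) ⊛ G                ≈⟨ ⊛-congˡ G (λ n → trans (⊛-comm P (one ⊖ X) n) ([one⊖X]-⊛ P n)) ⟩
    Δ P ⊛ G                            ≈⟨ Δ-⊛ P G ⟩
    Δ (P ⊛ G)                          ≈⟨ Δ-cong P⊛G ⟩
    Δ (Δ G ⊖ shift (suc d) G)          ≈⟨ Δ-cong Δ-genFun-⊖-shift ⟩
    Δ (shift 1 (geom d))               ≈⟨ Δ-shift (geom d) ⟩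
    shift 1 (Δ (geom d))               ≈⟨ shift-cong 1 (Δ-geom d) ⟩
    shift 1 (one ⊖ shift (suc d) one)  ≈⟨ shift-cong 1 (λ n → cong (ℤ._-_ (one n)) (Xpow≗shift-one (suc d) n)) ⟨
    shift 1 (one ⊖ Xpow (suc d))       ≈⟨ X-⊛ (one ⊖ Xpow (suc d)) ⟨
    X ⊛ (one ⊖ Xpow (suc d))           ∎
    where
    open import Relation.Binary.Reasoning.Setoid (ℕ →-setoid ℤ)
    P : Series
    P = one ⊖ X ⊖ Xpow (suc d)
    P⊛G : P ⊛ G ≗ Δ G ⊖ shift (suc d) G
    P⊛G n = trans (⊛-distribʳ-⊖ (one ⊖ X) (Xpow (suc d)) G n)
                  (cong₂ ℤ._-_ ([one⊖X]-⊛ G n) (Xpow-⊛ (suc d) G n))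

-- the leg of a cell in column j of a row lying above the rows t
countAbove : ℕ → List ℕ → ℕ
countAbove j t = length (filterᵇ (j <ᵇ_) t)

countAbove-accept : ∀ {j x} xs → j < x → countAbove j (x ∷ xs) ≡ suc (countAbove j xs)
countAbove-accept {j} {x} xs j<x = cong length (filter-accept (T? ∘ (j <ᵇ_)) {x} {xs} (<⇒<ᵇ j<x))

countAbove-none : ∀ {j xs} → All (_≤ j) xs → countAbove j xs ≡ 0
countAbove-none {j} xs≤j =
  cong length (filter-none (T? ∘ (j <ᵇ_)) (All.map (λ x≤j j<ᵇx → <⇒≱ (<ᵇ⇒< j _ j<ᵇx) x≤j) xs≤j))

countAbove-all : ∀ {xs} → All (0 <_) xs → countAbove 0 xs ≡ length xs
countAbove-all pos = cong length (filter-all (T? ∘ (0 <ᵇ_)) (All.map <⇒<ᵇ pos))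

below-head : ∀ {x xs} → Linked _>_ (x ∷ xs) → All (_< x) xs
below-head [-]        = []
below-head (x>y ∷ lk) = Linked⇒All {R = _>_} (flip <-trans) x>y lk

countAbove-step : ∀ j {t} → Linked _>_ t → countAbove j t ≤ suc (countAbove (suc j) t)
countAbove-step j {[]}     lk = z≤n
countAbove-step j {x ∷ xs} lk with <-cmp x (suc j)
... | tri< x<1+j _ _ = ≤-trans (≤-reflexive (countAbove-none (≤-pred x<1+j ∷ xs≤j))) z≤n
  where xs≤j = All.map (λ y<x → ≤-pred (<-trans y<x x<1+j)) (below-head lk)
... | tri≈ _ refl _ = begin
  countAbove j (suc j ∷ xs)  ≡⟨ countAbove-accept xs ≤-refl ⟩
  suc (countAbove j xs)      ≡⟨ cong suc (countAbove-none (All.map ≤-pred (below-head lk))) ⟩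
  1                          ≤⟨ s≤s z≤n ⟩
  suc (countAbove (suc j) (suc j ∷ xs)) ∎
  where open ≤-Reasoning
... | tri> _ _ 1+j<x = begin
  countAbove j (x ∷ xs)                     ≡⟨ countAbove-accept xs (<-trans (n<1+n j) 1+j<x) ⟩
  suc (countAbove j xs)                     ≤⟨ s≤s (countAbove-step j (Linked.tail lk)) ⟩
  suc (suc (countAbove (suc j) xs))         ≡⟨ cong suc (countAbove-accept xs 1+j<x) ⟨
  suc (countAbove (suc j) (x ∷ xs))         ∎
  where open ≤-Reasoning

-- a discrete intermediate value theorem
descent-hits : ∀ (g : ℕ → ℕ) {s} m → s ≤ g 0 → g m ≤ suc s →
               (∀ j → j < m → g j ≤ 2 + g (suc j)) →
               ∃[ j ] j ≤ m × (g j ≡ s ⊎ g j ≡ suc s)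
descent-hits g {s} m s≤g0 gm≤1+s step with g 0 ≤? suc s
... | yes g0≤1+s =
  0 , z≤n , [ (λ s<g0 → inj₂ (≤-antisym g0≤1+s s<g0)) , (λ s≡g0 → inj₁ (sym s≡g0)) ]′ (m≤n⇒m<n∨m≡n s≤g0)
descent-hits g zero    s≤g0 gm≤1+s step | no g0≰1+s = contradiction gm≤1+s g0≰1+s
descent-hits g (suc m) s≤g0 gm≤1+s step | no g0≰1+s
  with j , j≤m , hit ← descent-hits (g ∘ suc) m (≤-pred (≤-pred (≤-trans (≰⇒> g0≰1+s) (step 0 z<s))))
                                    gm≤1+s (λ j j<m → step (suc j) (s≤s j<m))
  = suc j , s≤s j≤m , hit

firstRow-hook-first : ∀ {h t} → All (0 <_) t → hook (suc h ∷ t) zero 0 ≡ suc h + length t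
firstRow-hook-first {h} pos = cong (λ c → suc (h + c)) (countAbove-all pos)

firstRow-hook-last : ∀ {h t} → Linked _>_ (suc h ∷ t) → hook (suc h ∷ t) zero h ≡ 1
firstRow-hook-last {h} lk =
  cong₂ (λ a c → suc (a + c)) (n∸n≡0 h) (countAbove-none (All.map ≤-pred (below-head lk)))

firstRow-hook-step : ∀ {h t j} → Linked _>_ (suc h ∷ t) → j < h →
                     hook (suc h ∷ t) zero j ≤ 2 + hook (suc h ∷ t) zero (suc j)
firstRow-hook-step {h} {t} {j} lk j<h = begin
  suc (h ∸ j + countAbove j t)                           ≡⟨ cong (λ a → suc (a + countAbove j t)) (+-∸-assoc 1 j<h) ⟩
  suc (suc (h ∸ suc j) + countAbove j t)                 ≤⟨ s≤s (+-monoʳ-≤ (suc (h ∸ suc j)) (countAbove-step j (Linked.tail lk))) ⟩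
  suc (suc (h ∸ suc j) + suc (countAbove (suc j) t))     ≡⟨ cong suc (+-suc (suc (h ∸ suc j)) _) ⟩
  2 + suc (h ∸ suc j + countAbove (suc j) t)             ∎
  where open ≤-Reasoning

firstRow-hits : ∀ {s h t} → IsPartition (h ∷ t) → Linked _>_ (h ∷ t) → s ≤ h + length t →
                HasHook s (h ∷ t) ⊎ HasHook (suc s) (h ∷ t)
firstRow-hits {s} {suc h} {t} (_ ∷ pos , _) lk s≤corner
  with j , j≤h , hit ← descent-hits (hook (suc h ∷ t) zero) h
         (subst (s ≤_) (sym (firstRow-hook-first pos)) s≤corner)
         (subst (_≤ suc s) (sym (firstRow-hook-last lk)) (s≤s z≤n))
         (λ j → firstRow-hook-step lk)
  = Sum.map (λ eq → zero , j , s≤s j≤h , eq) (λ eq → zero , j , s≤s j≤h , eq) hit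

-- all hooks are < m, as the corner hook h + length t is the largest one (hook≤corner)
HooksBelow : ℕ → List ℕ → Set
HooksBelow m []      = ⊤
HooksBelow m (h ∷ t) = h + length t < m

hook≤corner : ∀ {h t} → IsPartition (h ∷ t) → ∀ i j → j < lookup (h ∷ t) i →
              hook (h ∷ t) i j ≤ h + length t
hook≤corner {h} {t} (_ , lk) i j j<λᵢ = +-mono-≤ arm<h leg≤|t|
  where
  λᵢ = lookup (h ∷ t) i
  arm<h : suc (λᵢ ∸ suc j) ≤ h
  arm<h = begin
    suc (λᵢ ∸ suc j)  ≡⟨ +-∸-assoc 1 j<λᵢ ⟨
    λᵢ ∸ j            ≤⟨ m∸n≤m λᵢ j ⟩
    λᵢ                ≤⟨ All.lookup (Linked⇒All {R = _≥_} (flip ≤-trans) ≤-refl lk) (∈-lookup i) ⟩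
    h                 ∎
    where open ≤-Reasoning
  leg≤|t| : leg (h ∷ t) i j ≤ length t
  leg≤|t| = begin
    leg (h ∷ t) i j          ≤⟨ length-filter (T? ∘ (j <ᵇ_)) (drop (toℕ i) t) ⟩
    length (drop (toℕ i) t)  ≡⟨ length-drop (toℕ i) t ⟩
    length t ∸ toℕ i         ≤⟨ m∸n≤m (length t) (toℕ i) ⟩
    length t                 ∎
    where open ≤-Reasoning

hooksBelow⇒core : ∀ {m u λs} → IsPartition λs → HooksBelow m λs → m ≤ u → IsCore u λs
hooksBelow⇒core {λs = []}    _ _ _ (() , _)
hooksBelow⇒core {λs = h ∷ t} p corner<m m≤u (i , j , j<λᵢ , hook≡u) =
  <⇒≱ (≤-trans corner<m m≤u) (subst (_≤ h + length t) hook≡u (hook≤corner p i j j<λᵢ))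

core⇒hooksBelow : ∀ {s λs} → IsPartition λs → Linked _>_ λs →
                  IsCore s λs → IsCore (suc s) λs → HooksBelow s λs
core⇒hooksBelow {λs = []}    _ _ _ _ = tt
core⇒hooksBelow {s} {h ∷ t} p lk s-core 1+s-core with h + length t <? s
... | yes corner<s = corner<s
... | no  corner≮s = ⊥-elim ([ s-core , 1+s-core ]′ (firstRow-hits p lk (≮⇒≥ corner≮s)))

HooksBelow⇒length≤ : ∀ {m} (μ : List ℕ) → HooksBelow m μ → length μ ≤ m
HooksBelow⇒length≤ []      _        = z≤n
HooksBelow⇒length≤ (x ∷ t) corner<m = ≤-trans (s≤s (m≤n+m (length t) x)) corner<m

m<n∸o⇒m+o<n : ∀ m n o → m < n ∸ o → m + o < n
m<n∸o⇒m+o<n m n       zero    m<n   = subst (_< n) (sym (+-identityʳ m)) m<n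
m<n∸o⇒m+o<n m (suc n) (suc o) m<n∸o = subst (_< suc n) (sym (+-suc m o)) (s≤s (m<n∸o⇒m+o<n m n o m<n∸o))

private
  rearrange : ∀ d x ℓ → suc (x + ℓ) + d ≡ d + x + suc ℓ
  rearrange = solve-∀

module _ (d : ℕ) where

  HookBounded : ℕ → List ℕ → Set
  HookBounded m λs = IsPartition λs × DDistinct d λs × HooksBelow m λs

  []-hookBounded : ∀ m → HookBounded m []
  []-hookBounded m = ([] , []) , [] , tt

  HookBounded-mono : ∀ {m m′} (λs : List ℕ) → m ≤ m′ → HookBounded m λs → HookBounded m′ λs
  HookBounded-mono {m′ = m′} []      _    _                   = []-hookBounded m′
  HookBounded-mono           (_ ∷ _) m≤m′ (p , dd , corner<m) = p , dd , <-≤-trans corner<m m≤m′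

  extend : ℕ → List ℕ → List ℕ
  extend M μ = M ∸ length μ ∷ μ

  extend-¬hooksBelow : ∀ {M} (μ : List ℕ) → length μ ≤ M → ¬ HooksBelow M (extend M μ)
  extend-¬hooksBelow μ |μ|≤M corner<M = <-irrefl (m∸n+n≡m |μ|≤M) corner<M

  extend-hookBounded : ∀ {M} (μ : List ℕ) → HookBounded (suc M ∸ d) μ → HookBounded (suc (suc M)) (extend (suc M) μ)
  extend-hookBounded []       _ = (z<s ∷ [] , [-]) , [-] , s≤s (≤-reflexive (+-identityʳ _))
  extend-hookBounded {M} (x ∷ t) ((0<x ∷ pos , lk) , dd , corner<M+1∸d) =
    (≤-trans 0<x x≤head ∷ 0<x ∷ pos , x≤head ∷ lk) , d+x≤head ∷ dd ,
    s≤s (≤-reflexive (m∸n+n≡m |μ|≤M+1))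
    where
    d+x≤head : d + x ≤ suc M ∸ suc (length t)
    d+x≤head = m+n≤o⇒m≤o∸n (d + x) (begin
      d + x + suc (length t)   ≡⟨ rearrange d x (length t) ⟨
      suc (x + length t) + d   ≤⟨ m<n∸o⇒m+o<n (x + length t) (suc M) d corner<M+1∸d ⟩
      suc M                    ∎)
      where open ≤-Reasoning
    x≤head = ≤-trans (m≤n+m x d) d+x≤head
    |μ|≤M+1 = ≤-trans (HooksBelow⇒length≤ (x ∷ t) corner<M+1∸d) (m∸n≤m (suc M) d)

  tail-hookBounded : ∀ {m M h} (t : List ℕ) → HookBounded m (h ∷ t) → h + length t ≡ M → HookBounded (M ∸ d) t
  tail-hookBounded {M = M} [] _ _ = []-hookBounded (M ∸ d)
  tail-hookBounded {M = M} {h} (x ∷ t) ((_ ∷ pos , _ ∷ lk) , d+x≤h ∷ dd , _) corner≡M =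
    (pos , lk) , dd , m+n≤o⇒m≤o∸n (suc (x + length t)) (begin
      suc (x + length t) + d   ≡⟨ rearrange d x (length t) ⟩
      d + x + suc (length t)   ≤⟨ +-monoˡ-≤ (suc (length t)) d+x≤h ⟩
      h + suc (length t)       ≡⟨ corner≡M ⟩
      M                        ∎)
    where open ≤-Reasoning

  hookBounded-split : ∀ {M} (λs : List ℕ) → HookBounded (suc M) λs →
                      HookBounded M λs ⊎ ∃[ μ ] λs ≡ extend M μ × HookBounded (M ∸ d) μ
  hookBounded-split {M} []    _ = inj₁ ([]-hookBounded M)
  hookBounded-split {M} (h ∷ t) b@(p , dd , corner<1+M) with h + length t <? M
  ... | yes corner<M = inj₁ (p , dd , corner<M)
  ... | no  corner≮M = inj₂ (t , cong (_∷ t) h≡M∸|t| , tail-hookBounded t b corner≡M)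
    where
    corner≡M = ≤-antisym (≤-pred corner<1+M) (≮⇒≥ corner≮M)
    h≡M∸|t| = trans (sym (m+n∸n≡m h (length t))) (cong (_∸ length t) corner≡M)

  -- enum f m lists the partitions in HookBounded m, provided the fuel f is at least m
  enum : ℕ → ℕ → List (List ℕ)
  enum f       zero          = [] ∷ []
  enum f       (suc zero)    = [] ∷ []
  enum zero    (suc (suc m)) = []
  enum (suc f) (suc (suc m)) = enum f (suc m) ++ map (extend (suc m)) (enum f (suc m ∸ d))

  enum-sound : ∀ f m {λs} → λs ∈ enum f m → HookBounded m λs
  enum-sound f       zero          (here refl) = []-hookBounded 0
  enum-sound f       (suc zero)    (here refl) = []-hookBounded 1
  enum-sound (suc f) (suc (suc m)) λs∈ with ∈-++⁻ (enum f (suc m)) λs∈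
  ... | inj₁ λs∈₁ = HookBounded-mono _ (n≤1+n (suc m)) (enum-sound f (suc m) λs∈₁)
  ... | inj₂ λs∈₂ with μ , μ∈ , refl ← ∈-map⁻ (extend (suc m)) λs∈₂ =
    extend-hookBounded μ (enum-sound f (suc m ∸ d) μ∈)

  enum-complete : ∀ f m {λs} → m ≤ f → HookBounded m λs → λs ∈ enum f m
  enum-complete f       zero       {[]}        _ _                             = here refl
  enum-complete f       (suc zero) {[]}        _ _                             = here refl
  enum-complete f       (suc zero) {zero ∷ _}  _ ((() ∷ _ , _) , _)
  enum-complete f       (suc zero) {suc _ ∷ _} _ (_ , _ , s≤s ())
  enum-complete (suc f) (suc (suc m)) {λs} (s≤s 1+m≤f) b with hookBounded-split λs b
  ... | inj₁ b′ = ∈-++⁺ˡ (enum-complete f (suc m) 1+m≤f b′)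
  ... | inj₂ (μ , refl , bμ) = ∈-++⁺ʳ (enum f (suc m))
    (∈-map⁺ (extend (suc m)) (enum-complete f (suc m ∸ d) (≤-trans (m∸n≤m (suc m) d) 1+m≤f) bμ))

  enum-unique : ∀ f m → Unique (enum f m)
  enum-unique f       zero          = [] ∷ []
  enum-unique f       (suc zero)    = [] ∷ []
  enum-unique zero    (suc (suc m)) = []
  enum-unique (suc f) (suc (suc m)) =
    Unique.++⁺ (enum-unique f (suc m)) (Unique.map⁺ ∷-injectiveʳ (enum-unique f (suc m ∸ d))) disjoint
    where
    disjoint : Disjoint (enum f (suc m)) (map (extend (suc m)) (enum f (suc m ∸ d)))
    disjoint (v∈₁ , v∈₂) with μ , μ∈ , refl ← ∈-map⁻ (extend (suc m)) v∈₂ =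
      let _ , _ , μ-hooks = enum-sound f (suc m ∸ d) μ∈
          _ , _ , v-hooks = enum-sound f (suc m) v∈₁
      in  extend-¬hooksBelow μ (≤-trans (HooksBelow⇒length≤ μ μ-hooks) (m∸n≤m (suc m) d)) v-hooks

  enum-fuel : ∀ f m → m ≤ f → enum f m ≡ enum (suc f) m
  enum-fuel f       zero          _            = refl
  enum-fuel f       (suc zero)    _            = refl
  enum-fuel (suc f) (suc (suc m)) (s≤s 1+m≤f) =
    cong₂ _++_ (enum-fuel f (suc m) 1+m≤f)
               (cong (map (extend (suc m))) (enum-fuel f (suc m ∸ d) (≤-trans (m∸n≤m (suc m) d) 1+m≤f)))

  enum-stable : ∀ f m → m ≤ f → enum f m ≡ enum m m
  enum-stable zero    zero z≤n  = refl
  enum-stable (suc f) m    m≤1+f with m ≤? f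
  ... | yes m≤f = trans (sym (enum-fuel f m m≤f)) (enum-stable f m m≤f)
  ... | no  m≰f rewrite ≤-antisym m≤1+f (≰⇒> m≰f) = refl

  count : ℕ → ℕ
  count m = length (enum m m)

  count-rec : ∀ m → count (2 + m) ≡ count (1 + m) + count (1 + m ∸ d)
  count-rec m = begin
    length (enum (suc m) (suc m) ++ map (extend (suc m)) (enum (suc m) (suc m ∸ d)))
      ≡⟨ length-++ (enum (suc m) (suc m)) ⟩
    count (suc m) + length (map (extend (suc m)) (enum (suc m) (suc m ∸ d)))
      ≡⟨ cong (_+_ (count (suc m))) (length-map (extend (suc m)) (enum (suc m) (suc m ∸ d))) ⟩
    count (suc m) + length (enum (suc m) (suc m ∸ d))
      ≡⟨ cong (λ l → count (suc m) + length l) (enum-stable (suc m) (suc m ∸ d) (m∸n≤m (suc m) d)) ⟩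
    count (suc m) + count (suc m ∸ d) ∎
    where open ≡-Reasoning

  hookBounded-count : ∀ m → HasCount (HookBounded m) (count m)
  hookBounded-count m =
    enum m m , enum-unique m m , All.tabulate (enum-sound m m) , (λ _ → enum-complete m m ≤-refl) , refl

HasCount-resp : ∀ {A : Set} {P Q : A → Set} {n} →
                (∀ {a} → P a → Q a) → (∀ {a} → Q a → P a) → HasCount P n → HasCount Q n
HasCount-resp P⇒Q Q⇒P (L , unique , all , complete , length≡n) =
  L , unique , All.map P⇒Q all , (λ a → complete a ∘ Q⇒P) , length≡n

DDistinct⇒strict : ∀ {d λs} → DDistinct (suc d) λs → Linked _>_ λs
DDistinct⇒strict {d} = Linked.map (λ {a} {b} → ≤-trans (s≤s (m≤n+m b d)))

good⇒hookBounded : ∀ {d s λs} → Good (suc d) s λs → HookBounded (suc d) s λs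
good⇒hookBounded (p , s-core , 1+s-core , dd) =
  p , dd , core⇒hooksBelow p (DDistinct⇒strict dd) s-core 1+s-core

hookBounded⇒good : ∀ {d s λs} → HookBounded d s λs → Good d s λs
hookBounded⇒good {s = s} (p , dd , hooks<s) =
  p , hooksBelow⇒core p hooks<s ≤-refl , hooksBelow⇒core p hooks<s (n≤1+n s) , dd

lemma5p1 : (d : ℕ) → 1 ≤ d →
    Σ (ℕ → ℕ) λ N →
    ((s : ℕ) → 1 ≤ s → HasCount (Good d s) (N s)) ×
    ((n : ℕ) → (genFun N ⊛ ((one ⊖ X ⊖ Xpow (suc d)) ⊛ (one ⊖ X))) n
    ≡ (X ⊛ (one ⊖ Xpow (suc d))) n)
lemma5p1 (suc d) _ =
  count (suc d) ,
  (λ s _ → HasCount-resp hookBounded⇒good good⇒hookBounded (hookBounded-count (suc d) s)) ,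
  genFun-identity {suc d} {count (suc d)} refl refl (count-rec (suc d))
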